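{- Let $X$ be an ideal of black-white colorings (an ideal in $(\mathcal{C}(D_2),\preceq)$). If there is $i\in\{3,4\}$ such that for every $r\ge1$ the set $X$ contains an $r$-wealthy coloring of type $i$, then $|X_n|\ge F_n$ for all $n\ge1$, where $F_0=F_1=1$ and $F_n=F_{n-1}+F_{n-2}$.
   Context: A coloring is a pair $(n,\chi)$ with $n\in\mathbb{N}_0$ and $\chi:\binom{[n]}{2}\to\{\text{black},\text{white}\}$; $(m,\psi)\preceq(n,\chi)$ iff there is an increasing $f:[m]\to[n]$ with $\psi(\{i,j\})=\chi(\{f(i),f(j)\})$ for all $i<j$. An ideal is a down-closed set of colorings; $X_n=\{(n,\chi)\in X\}$. For a coloring $K=(2r,\chi)$, $M_K$ is the $r\times r$ 0-1 matrix with $M_K(i,j)=0$ iff $\chi(\{i,r+j\})=\text{white}$. $I_r$ is the $r\times r$ identity matrix; $U_r$ is the $r\times r$ matrix with $U_r(i,j)=1$ iff $i\le j$. Two 0-1 matrices of the same dimensions are similar if one is obtained from the other by possibly taking the vertical mirror image (reversing the order of the columns) and/or swapping 0 and 1. $K=(2r,\chi)$ is $r$-wealthy of type 3 if $M_K$ is similar to $I_r$, and $r$-wealthy of type 4 if $M_K$ is similar to $U_r$. -}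

module Defs where

open import Data.Nat using (ℕ; zero; suc; _+_; _≥_)
open import Data.Fin using (Fin; toℕ; _↑ˡ_; _↑ʳ_; opposite; _<_)
open import Data.Fin.Properties using (_≟_; _≤?_)
open import Data.Bool using (Bool; true; false; not)
open import Data.Product using (Σ; _×_; _,_; ∃)
open import Data.Sum using (_⊎_)
open import Relation.Nullary.Decidable using (⌊_⌋)
open import Relation.Binary.PropositionalEquality using (_≡_)

data Colour : Set where
  black white : Colour

-- A colouring of the pairs of [n]: only the values χ i j with i < j matter
-- (the pair {i,j} with i<j is coloured χ i j).
Col : ℕ → Set
Col n = Fin n → Fin n → Colour

record Coloring : Set where
  constructor ⟨_,_⟩
  field
    size : ℕ
    col  : Col size
open Coloring public

_≈_ : {n : ℕ} → Col n → Col n → Set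
_≈_ {n} ψ χ = (i j : Fin n) → i < j → ψ i j ≡ χ i j

_⪯_ : Coloring → Coloring → Set
⟨ m , ψ ⟩ ⪯ ⟨ n , χ ⟩ =
  Σ (Fin m → Fin n) λ f →
    ((i j : Fin m) → i < j → f i < f j) ×
    ((i j : Fin m) → i < j → ψ i j ≡ χ (f i) (f j))

IsIdeal : (Coloring → Set) → Set
IsIdeal X = (K L : Coloring) → L ⪯ K → X K → X L

-- 0-1 matrices (true = 1, false = 0).
Matrix : ℕ → Set
Matrix r = Fin r → Fin r → Bool

-- M_K for K = (2r, χ): vertex i ↦ i ↑ˡ r, vertex r+j ↦ r ↑ʳ j;
-- entry is 0 iff the pair {i, r+j} is white.
isNotWhite : Colour → Bool
isNotWhite black = true
isNotWhite white = false

M : (r : ℕ) → Col (r + r) → Matrix r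
M r χ i j = isNotWhite (χ (i ↑ˡ r) (r ↑ʳ j))

I : (r : ℕ) → Matrix r
I r i j = ⌊ i ≟ j ⌋

U : (r : ℕ) → Matrix r
U r i j = ⌊ i ≤? j ⌋

_≐_ : {r : ℕ} → Matrix r → Matrix r → Set
_≐_ {r} A B = (i j : Fin r) → A i j ≡ B i j

mirror : {r : ℕ} → Matrix r → Matrix r
mirror A i j = A i (opposite j)

complement : {r : ℕ} → Matrix r → Matrix r
complement A i j = not (A i j)

Similar : {r : ℕ} → Matrix r → Matrix r → Set
Similar A B = (A ≐ B) ⊎ (A ≐ mirror B) ⊎ (A ≐ complement B)
              ⊎ (A ≐ complement (mirror B))

Wealthy3 : (r : ℕ) → Col (r + r) → Set
Wealthy3 r χ = Similar (M r χ) (I r)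

Wealthy4 : (r : ℕ) → Col (r + r) → Set
Wealthy4 r χ = Similar (M r χ) (U r)

RichInType : (W : (r : ℕ) → Col (r + r) → Set) → (Coloring → Set) → Set
RichInType W X = (r : ℕ) → r ≥ 1 → Σ (Col (r + r)) λ χ → X ⟨ r + r , χ ⟩ × W r χ

F : ℕ → ℕ
F zero = 1
F (suc zero) = 1
F (suc (suc n)) = F (suc n) + F n

-- |X_n| ≥ k: there are k pairwise distinct colourings on [n] lying in X,
-- i.e. an injection Fin k → X_n (distinct = differ on some pair).
AtLeast : (Coloring → Set) → ℕ → ℕ → Set
AtLeast X n k =
  Σ (Fin k → Col n) λ g →
    ((a : Fin k) → X ⟨ n , g a ⟩) ×
    ((a b : Fin k) → g a ≈ g b → a ≡ b)

{-# OPTIONS --safe #-}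
module Submission where

open import Data.Bool using (Bool)
open import Data.Bool.Properties using (not-injective)
open import Data.Empty using (⊥-elim)
open import Data.Fin using (Fin; zero; suc; toℕ; _↑ˡ_; _↑ʳ_; splitAt; join; opposite; _<_)
open import Data.Fin.Properties
  using ( _≟_; _≤?_; <-asym; toℕ<n; toℕ-↑ˡ; toℕ-↑ʳ; splitAt-↑ˡ; splitAt-↑ʳ; +↔⊎
        ; opposite-prop; opposite-involutive)
open import Data.Nat as ℕ using (ℕ; zero; suc; _+_; _≥_; ⌊_/2⌋; ⌈_/2⌉; z≤n; s≤s; s≤s⁻¹)
open import Data.Nat.Properties
  using (⌊n/2⌋+⌈n/2⌉≡n; m≤m+n; +-cancelˡ-<; ∸-monoʳ-<; module ≤-Reasoning)
open import Data.Product using (Σ-syntax; _,_)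
open import Data.Sum as Sum using (_⊎_; inj₁; inj₂; [_,_]′)
open import Data.Vec.Functional using (_∷_)
open import Function using (_∘_; id; mk⇔; Injection)
open import Function.Definitions using (Injective)
open import Function.Properties.Inverse using (↔⇒↣)
open import Relation.Binary.Core using (_Preserves_⟶_)
open import Relation.Binary.PropositionalEquality
  using (_≡_; refl; sym; trans; cong; cong₂; subst; subst₂)
open import Relation.Nullary using (¬_)
open import Relation.Nullary.Decidable using (does-⇔; isYes≗does; ⌊⌋-map′)

open import Defs

-- Let K = (2n, χ) ∈ X have M_K similar to B ∈ {I_n, U_n}. For row positions A and
-- column positions C in [n], restricting χ to A ∪ (n + C) gives a colouring in X whose
-- pairs across the two parts record M_K[A, C], which is B[A, C] up to reversing the
-- columns and negating the entries. So it suffices to find F_n choices of (A, C), all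
-- of shape ⌊n/2⌋ × ⌈n/2⌉, with pairwise distinct submatrices of B. They come from the
-- F_n tilings of [n] by monominoes and dominoes, read from left to right: a monomino
-- puts its cell alternately into C and into A, and a domino adds one row and one column
-- within its two cells, placed so that the entry of B between them differs from the
-- entry a monomino would create at the same place. Two tilings first differ where one
-- has a monomino and the other a domino, and there their submatrices differ.

variable
  k m r s n N k′ m′ : ℕ
  Ix Jx : Set

↑ˡ-<-↑ʳ : (i : Fin k) (j : Fin m) → i ↑ˡ m < k ↑ʳ j
↑ˡ-<-↑ʳ {k} {m} i j = begin-strict
  toℕ (i ↑ˡ m)  ≡⟨ toℕ-↑ˡ i m ⟩
  toℕ i         <⟨ toℕ<n i ⟩
  k             ≤⟨ m≤m+n k (toℕ j) ⟩
  k + toℕ j     ≡⟨ toℕ-↑ʳ k j ⟨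
  toℕ (k ↑ʳ j)  ∎
  where open ≤-Reasoning

↑ˡ-pres-< : {i j : Fin k} → i < j → i ↑ˡ m < j ↑ˡ m
↑ˡ-pres-< {m = m} {i} {j} = subst₂ ℕ._<_ (sym (toℕ-↑ˡ i m)) (sym (toℕ-↑ˡ j m))

↑ˡ-cancel-< : {i j : Fin k} → i ↑ˡ m < j ↑ˡ m → i < j
↑ˡ-cancel-< {m = m} {i} {j} = subst₂ ℕ._<_ (toℕ-↑ˡ i m) (toℕ-↑ˡ j m)

↑ʳ-pres-< : ∀ k {i j : Fin m} → i < j → k ↑ʳ i < k ↑ʳ j
↑ʳ-pres-< zero    i<j = i<j
↑ʳ-pres-< (suc k) i<j = s≤s (↑ʳ-pres-< k i<j)

↑ʳ-cancel-< : ∀ k {i j : Fin m} → k ↑ʳ i < k ↑ʳ j → i < j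
↑ʳ-cancel-< k {i} {j} =
  +-cancelˡ-< k (toℕ i) (toℕ j) ∘ subst₂ ℕ._<_ (toℕ-↑ʳ k i) (toℕ-↑ʳ k j)

opposite-< : {i j : Fin n} → i < j → opposite j < opposite i
opposite-< {n} {i} {j} i<j = subst₂ ℕ._<_ (sym (opposite-prop j)) (sym (opposite-prop i))
  (∸-monoʳ-< {n} {suc (toℕ j)} {suc (toℕ i)} (s≤s i<j) (toℕ<n j))

∷-increasing : {x : Fin n} {f : Fin k → Fin n} →
  (∀ i → x < f i) → f Preserves _<_ ⟶ _<_ → (x ∷ f) Preserves _<_ ⟶ _<_
∷-increasing x<f f↑ {zero}  {suc j} _          = x<f j
∷-increasing x<f f↑ {suc i} {suc j} (s≤s i<j) = f↑ i<j

splitAt-injective : ∀ k → Injective _≡_ _≡_ (splitAt k {m})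
splitAt-injective k = Injection.injective (↔⇒↣ (+↔⊎ {k}))

data SplitView (k m : ℕ) : Fin (k + m) → Set where
  left  : (i : Fin k) → SplitView k m (i ↑ˡ m)
  right : (j : Fin m) → SplitView k m (k ↑ʳ j)

splitView : ∀ k m (p : Fin (k + m)) → SplitView k m p
splitView zero    m p       = right p
splitView (suc k) m zero    = left zero
splitView (suc k) m (suc p) with splitView k m p
... | left i  = left (suc i)
... | right j = right j

_⊕_ : (Fin k → Fin r) → (Fin m → Fin s) → Fin (k + m) → Fin (r + s)
_⊕_ {k} {r} {s = s} f g = join r s ∘ Sum.map f g ∘ splitAt k

⊕-↑ˡ : (f : Fin k → Fin r) (g : Fin m → Fin s) (i : Fin k) → (f ⊕ g) (i ↑ˡ m) ≡ f i ↑ˡ s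
⊕-↑ˡ {k} {r} {m} {s} f g i = cong (join r s ∘ Sum.map f g) (splitAt-↑ˡ k i m)

⊕-↑ʳ : (f : Fin k → Fin r) (g : Fin m → Fin s) (j : Fin m) → (f ⊕ g) (k ↑ʳ j) ≡ r ↑ʳ g j
⊕-↑ʳ {k} {r} {m} {s} f g j = cong (join r s ∘ Sum.map f g) (splitAt-↑ʳ k m j)

⊕-increasing : {f : Fin k → Fin r} {g : Fin m → Fin s} →
  f Preserves _<_ ⟶ _<_ → g Preserves _<_ ⟶ _<_ → (f ⊕ g) Preserves _<_ ⟶ _<_
⊕-increasing {k} {r} {m} {f = f} {g} f↑ g↑ {p} {q} p<q with splitView k m p | splitView k m q
... | left i  | left i′
  rewrite ⊕-↑ˡ f g i | ⊕-↑ˡ f g i′ = ↑ˡ-pres-< (f↑ (↑ˡ-cancel-< p<q))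
... | left i  | right j
  rewrite ⊕-↑ˡ f g i | ⊕-↑ʳ f g j = ↑ˡ-<-↑ʳ (f i) (g j)
... | right j | left i  = ⊥-elim (<-asym p<q (↑ˡ-<-↑ʳ i j))
... | right j | right j′
  rewrite ⊕-↑ʳ f g j | ⊕-↑ʳ f g j′ = ↑ʳ-pres-< r (g↑ (↑ʳ-cancel-< k p<q))

record Selection (k m r : ℕ) : Set where
  field
    rows            : Fin k → Fin r
    cols            : Fin m → Fin r
    rows-increasing : rows Preserves _<_ ⟶ _<_
    cols-increasing : cols Preserves _<_ ⟶ _<_
open Selection

submatrix : Matrix r → Selection k m r → Fin k → Fin m → Bool
submatrix A S i j = A (rows S i) (cols S j)

SameSubmatrix : Matrix r → Selection k m r → Selection k m r → Set
SameSubmatrix A S T = ∀ i j → submatrix A S i j ≡ submatrix A T i j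

record Separating (A : Matrix r) (S : Ix → Selection k m r) : Set where
  constructor separating
  field separates : Injective _≡_ (SameSubmatrix A) S

restrict : Col (r + r) → Selection k m r → Col (k + m)
restrict χ S p q = χ ((rows S ⊕ cols S) p) ((rows S ⊕ cols S) q)

restrict-⪯ : (χ : Col (r + r)) (S : Selection k m r) →
  ⟨ k + m , restrict χ S ⟩ ⪯ ⟨ r + r , χ ⟩
restrict-⪯ χ S = rows S ⊕ cols S
  , (λ _ _ → ⊕-increasing (rows-increasing S) (cols-increasing S))
  , λ _ _ _ → refl

submatrix-M : (χ : Col (r + r)) (S : Selection k m r) (i : Fin k) (j : Fin m) →
  submatrix (M r χ) S i j ≡ isNotWhite (restrict χ S (i ↑ˡ m) (k ↑ʳ j))
submatrix-M χ S i j =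
  cong isNotWhite (sym (cong₂ χ (⊕-↑ˡ (rows S) (cols S) i) (⊕-↑ʳ (rows S) (cols S) j)))

separating⇒AtLeast : {X : Coloring → Set} {χ : Col (r + r)} → IsIdeal X → X ⟨ r + r , χ ⟩ →
  (S : Fin N → Selection k m r) → Separating (M r χ) S → AtLeast X (k + m) N
separating⇒AtLeast {χ = χ} ideal Xχ S (separating sep) =
  restrict χ ∘ S , (λ a → ideal _ _ (restrict-⪯ χ (S a)) Xχ) , λ a b same →
    sep λ i j → trans (submatrix-M χ (S a) i j)
      (trans (cong isNotWhite (same _ _ (↑ˡ-<-↑ʳ i j))) (sym (submatrix-M χ (S b) i j)))

separating-restriction : {A : Matrix r} {A′ : Matrix n}
  {S : Ix → Selection k m r} {T : Ix → Selection k′ m′ n}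
  (ρ : Fin k → Fin k′) (σ : Fin m → Fin m′) →
  (∀ a i j → submatrix A′ (T a) (ρ i) (σ j) ≡ submatrix A (S a) i j) →
  Separating A S → Separating A′ T
separating-restriction ρ σ T⊇S (separating sep) = separating λ {a} {b} same →
  sep λ i j → trans (sym (T⊇S a i j)) (trans (same (ρ i) (σ j)) (T⊇S b i j))

separating-≐ : {A B : Matrix r} {S : Ix → Selection k m r} →
  A ≐ B → Separating B S → Separating A S
separating-≐ A≐B = separating-restriction id id λ _ _ _ → A≐B _ _

separating-complement : {B : Matrix r} {S : Ix → Selection k m r} →
  Separating B S → Separating (complement B) S
separating-complement (separating sep) =
  separating λ same → sep λ i j → not-injective (same i j)

reverseCols : Selection k m r → Selection k m r
reverseCols S = record S
  { cols            = opposite ∘ cols S ∘ opposite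
  ; cols-increasing = opposite-< ∘ cols-increasing S ∘ opposite-<
  }

separating-mirror : {B : Matrix r} {S : Ix → Selection k m r} →
  Separating B S → Separating (mirror B) (reverseCols ∘ S)
separating-mirror {B = B} {S} = separating-restriction id opposite λ a i j →
  cong (B (rows (S a) i))
    (trans (opposite-involutive _) (cong (cols (S a)) (opposite-involutive j)))

similar-separating : {A B : Matrix r} {S : Ix → Selection k m r} → Similar A B → Separating B S →
  Σ[ T ∈ (Ix → Selection k m r) ] Separating A T
similar-separating {S = S} (inj₁ A≐B) sep = S , separating-≐ A≐B sep
similar-separating {S = S} (inj₂ (inj₁ A≐B′)) sep =
  reverseCols ∘ S , separating-≐ A≐B′ (separating-mirror sep)
similar-separating {S = S} (inj₂ (inj₂ (inj₁ A≐B′))) sep =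
  S , separating-≐ A≐B′ (separating-complement sep)
similar-separating {S = S} (inj₂ (inj₂ (inj₂ A≐B′))) sep =
  reverseCols ∘ S , separating-≐ A≐B′ (separating-complement (separating-mirror sep))

data Pattern : Set where
  identity upper : Pattern

patternMatrix : Pattern → (r : ℕ) → Matrix r
patternMatrix identity = I
patternMatrix upper    = U

patternMatrix-suc : ∀ p (x y : Fin r) →
  patternMatrix p (suc r) (suc x) (suc y) ≡ patternMatrix p r x y
patternMatrix-suc identity x y = ⌊⌋-map′ _ _ (x ≟ y)
patternMatrix-suc upper    x y = trans (isYes≗does (suc x ≤? suc y))
  (trans (does-⇔ (mk⇔ s≤s⁻¹ s≤s) (suc x ≤? suc y) (x ≤? y)) (sym (isYes≗does (x ≤? y))))

-- The side receiving the next lone vertex; lone vertices alternate between the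
-- sides, so that all selections built over [n] have the same shape.
data Side : Set where
  row column : Side

other : Side → Side
other row    = column
other column = row

rowCount colCount : Side → ℕ → ℕ
rowCount row    = ⌈_/2⌉
rowCount column = ⌊_/2⌋
colCount row    = ⌊_/2⌋
colCount column = ⌈_/2⌉

empty : Selection 0 0 0
empty = record
  { rows            = λ ()
  ; cols            = λ ()
  ; rows-increasing = λ { {()} }
  ; cols-increasing = λ { {()} }
  }

addRow : Selection k m n → Selection (suc k) m (suc n)
addRow S = record
  { rows            = zero ∷ suc ∘ rows S
  ; cols            = suc ∘ cols S
  ; rows-increasing = ∷-increasing (λ _ → s≤s z≤n) (s≤s ∘ rows-increasing S)
  ; cols-increasing = s≤s ∘ cols-increasing S
  }

addCol : Selection k m n → Selection k (suc m) (suc n)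
addCol S = record
  { rows            = suc ∘ rows S
  ; cols            = zero ∷ suc ∘ cols S
  ; rows-increasing = s≤s ∘ rows-increasing S
  ; cols-increasing = ∷-increasing (λ _ → s≤s z≤n) (s≤s ∘ cols-increasing S)
  }

addPair : Fin 2 → Fin 2 → Selection k m n → Selection (suc k) (suc m) (2 + n)
addPair {n = n} x y S = record
  { rows            = (x ↑ˡ n) ∷ (2 ↑ʳ_) ∘ rows S
  ; cols            = (y ↑ˡ n) ∷ (2 ↑ʳ_) ∘ cols S
  ; rows-increasing = ∷-increasing (λ _ → ↑ˡ-<-↑ʳ x _) (↑ʳ-pres-< 2 ∘ rows-increasing S)
  ; cols-increasing = ∷-increasing (λ _ → ↑ˡ-<-↑ʳ y _) (↑ʳ-pres-< 2 ∘ cols-increasing S)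
  }

single : (s : Side) → Selection (rowCount (other s) n) (colCount (other s) n) n →
  Selection (rowCount s (suc n)) (colCount s (suc n)) (suc n)
single row    = addRow
single column = addCol

-- Placed so that the pattern entry between the pair's row and column differs from
-- the entry a lone vertex on side s would create at the same place (single≢pair).
pair : Pattern → (s : Side) → Selection (rowCount s n) (colCount s n) n →
  Selection (rowCount s (2 + n)) (colCount s (2 + n)) (2 + n)
pair identity row    = addPair zero zero
pair identity column = addPair zero zero
pair upper    row    = addPair (suc zero) zero
pair upper    column = addPair zero (suc zero)

tilingSelection : Pattern → (s : Side) (n : ℕ) →
  Fin (F n) → Selection (rowCount s n) (colCount s n) n
tilingSelection p s      (suc zero)    = single s ∘ tilingSelection p (other s) zero
tilingSelection p s      (suc (suc n)) =
  [ single s ∘ tilingSelection p (other s) (suc n) , pair p s ∘ tilingSelection p s n ]′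
  ∘ splitAt (F (suc n))
tilingSelection p row    zero          = λ _ → empty
tilingSelection p column zero          = λ _ → empty

addRow-separating : ∀ p {S : Ix → Selection k m n} →
  Separating (patternMatrix p n) S → Separating (patternMatrix p (suc n)) (addRow ∘ S)
addRow-separating p = separating-restriction suc id λ _ _ _ → patternMatrix-suc p _ _

addCol-separating : ∀ p {S : Ix → Selection k m n} →
  Separating (patternMatrix p n) S → Separating (patternMatrix p (suc n)) (addCol ∘ S)
addCol-separating p = separating-restriction id suc λ _ _ _ → patternMatrix-suc p _ _

addPair-separating : ∀ p x y {S : Ix → Selection k m n} →
  Separating (patternMatrix p n) S → Separating (patternMatrix p (2 + n)) (addPair x y ∘ S)
addPair-separating p x y = separating-restriction suc suc λ _ _ _ →
  trans (patternMatrix-suc p _ _) (patternMatrix-suc p _ _)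

single-separating : ∀ p s {S : Ix → Selection (rowCount (other s) n) (colCount (other s) n) n} →
  Separating (patternMatrix p n) S → Separating (patternMatrix p (suc n)) (single s ∘ S)
single-separating p row    = addRow-separating p
single-separating p column = addCol-separating p

pair-separating : ∀ p s {S : Ix → Selection (rowCount s n) (colCount s n) n} →
  Separating (patternMatrix p n) S → Separating (patternMatrix p (2 + n)) (pair p s ∘ S)
pair-separating identity row    = addPair-separating identity zero zero
pair-separating identity column = addPair-separating identity zero zero
pair-separating upper    row    = addPair-separating upper (suc zero) zero
pair-separating upper    column = addPair-separating upper zero (suc zero)

single≢pair : ∀ p s (S : Selection (rowCount (other s) (suc n)) (colCount (other s) (suc n)) (suc n))
  (T : Selection (rowCount s n) (colCount s n) n) →
  ¬ SameSubmatrix (patternMatrix p (2 + n)) (single s S) (pair p s T)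
single≢pair identity row    S T same with () ← same zero zero
single≢pair identity column S T same with () ← same zero zero
single≢pair upper    row    S T same with () ← same zero zero
single≢pair upper    column S T same with () ← same zero zero

separating-⊎ : {A : Matrix r} {S : Ix → Selection k m r} {T : Jx → Selection k m r} →
  Separating A S → Separating A T → (∀ a b → ¬ SameSubmatrix A (S a) (T b)) →
  Separating A [ S , T ]′
separating-⊎ {A = A} {S = S} {T} (separating sepS) (separating sepT) S≢T =
  separating separates-⊎
  where
  separates-⊎ : Injective _≡_ (SameSubmatrix A) [ S , T ]′
  separates-⊎ {inj₁ a} {inj₁ b} same = cong inj₁ (sepS same)
  separates-⊎ {inj₂ a} {inj₂ b} same = cong inj₂ (sepT same)
  separates-⊎ {inj₁ a} {inj₂ b} same = ⊥-elim (S≢T a b same)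
  separates-⊎ {inj₂ a} {inj₁ b} same = ⊥-elim (S≢T b a λ i j → sym (same i j))

separating-splitAt : {A : Matrix r} {S : Fin k ⊎ Fin m → Selection k′ m′ r} →
  Separating A S → Separating A (S ∘ splitAt k)
separating-splitAt {k = k} (separating sep) = separating (splitAt-injective k ∘ sep)

tilingSelection-separating : ∀ p s n → Separating (patternMatrix p n) (tilingSelection p s n)
tilingSelection-separating p s zero = separating λ { {zero} {zero} _ → refl }
tilingSelection-separating p s (suc zero) =
  single-separating p s (tilingSelection-separating p (other s) zero)
tilingSelection-separating p s (suc (suc n)) = separating-splitAt (separating-⊎
  (single-separating p s (tilingSelection-separating p (other s) (suc n)))
  (pair-separating p s (tilingSelection-separating p s n))
  λ _ _ → single≢pair p s _ _)

similar⇒AtLeast : ∀ p {n} {X : Coloring → Set} {χ : Col (n + n)} →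
  IsIdeal X → X ⟨ n + n , χ ⟩ → Similar (M n χ) (patternMatrix p n) → AtLeast X n (F n)
similar⇒AtLeast p {n} {X} ideal Xχ similar
  with similar-separating similar (tilingSelection-separating p column n)
... | T , separatingT =
  subst (λ size → AtLeast X size (F n)) (⌊n/2⌋+⌈n/2⌉≡n n)
    (separating⇒AtLeast ideal Xχ T separatingT)

lemma3p11 : (X : Coloring → Set) → IsIdeal X →
    (RichInType Wealthy3 X ⊎ RichInType Wealthy4 X) →
    (n : ℕ) → n ≥ 1 → AtLeast X n (F n)
lemma3p11 X ideal (inj₁ rich) n n≥1 =
  let χ , Xχ , wealthy = rich n n≥1 in similar⇒AtLeast identity ideal Xχ wealthy
lemma3p11 X ideal (inj₂ rich) n n≥1 =
  let χ , Xχ , wealthy = rich n n≥1 in similar⇒AtLeast upper ideal Xχ wealthy
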